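{- Let $\mathbf{A}=(A,\varrho^{\mathbf{A}})$ be a countable graph. Then $\mathbf{A}$ is polymorphism-homogeneous if and only if (1) $\varrho^{\mathbf{A}}=\emptyset$, or (2) every connected component of $\mathbf{A}$ is isomorphic to the complete graph $K_2$, or (3) $\mathbf{A}$ has the Rado graph as a spanning subgraph.
   Context: A graph is a pair $(V,\varrho)$ where $\varrho$ is a symmetric irreflexive binary relation on $V$ (so homomorphisms map edges to edges and may not contract edges). For a relational structure $\mathbf{A}$ and $k\geq 1$, $\mathbf{A}^k$ is the direct power with carrier $A^k$, where a tuple of elements of $A^k$ is in a relation iff it is so coordinatewise. A $k$-ary polymorphism of $\mathbf{A}$ is a homomorphism $\mathbf{A}^k\to\mathbf{A}$; a $k$-ary local polymorphism is a homomorphism from a finite induced substructure of $\mathbf{A}^k$ to $\mathbf{A}$. $\mathbf{A}$ is polymorphism-homogeneous if for every $k\geq 1$ every $k$-ary local polymorphism extends to a $k$-ary polymorphism. "Has the Rado graph as a spanning subgraph" means that there is a graph isomorphic to the Rado graph (the countable random graph) on the vertex set $A$ whose edge set is contained in $\varrho^{\mathbf{A}}$. -}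

module Defs where

open import Level using (0ℓ)
open import Data.Nat using (ℕ; zero; suc; _<_; _≤_; _/_; _%_)
open import Data.Vec using (Vec)
open import Data.Vec.Relation.Binary.Pointwise.Inductive using (Pointwise)
open import Data.List using (List)
open import Data.List.Membership.Propositional using (_∈_)
open import Data.Product using (Σ; ∃; _×_; _,_)
open import Data.Sum using (_⊎_)
open import Relation.Nullary using (¬_)
open import Relation.Binary.PropositionalEquality using (_≡_; _≢_)
open import Relation.Binary.Construct.Closure.ReflexiveTransitive using (Star)
open import Function.Definitions using (Injective; Bijective)
open import Function.Bundles using (_⇔_)

record Graph : Set₁ where
  field
    V      : Set
    E      : V → V → Set
    E-sym  : ∀ {x y} → E x y → E y x
    E-irr  : ∀ {x} → ¬ E x x
open Graph public

Countable : Graph → Set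
Countable A = Σ (V A → ℕ) λ c → Injective _≡_ _≡_ c

Eᵏ : (A : Graph) (k : ℕ) → Vec (V A) k → Vec (V A) k → Set
Eᵏ A k = Pointwise (E A)

IsPolymorphism : (A : Graph) (k : ℕ) → (Vec (V A) k → V A) → Set
IsPolymorphism A k g = ∀ x y → Eᵏ A k x y → E A (g x) (g y)

-- k-ary local polymorphism with finite domain L (the induced substructure
-- of A^k on the elements of L); f is only relevant on L.
IsLocalPolymorphism : (A : Graph) (k : ℕ) → List (Vec (V A) k) → (Vec (V A) k → V A) → Set
IsLocalPolymorphism A k L f =
  ∀ x y → x ∈ L → y ∈ L → Eᵏ A k x y → E A (f x) (f y)

PolymorphismHomogeneous : Graph → Set
PolymorphismHomogeneous A =
  ∀ (k : ℕ) → 1 ≤ k → ∀ (L : List (Vec (V A) k)) (f : Vec (V A) k → V A) →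
  IsLocalPolymorphism A k L f →
  ∃ λ (g : Vec (V A) k → V A) → IsPolymorphism A k g × (∀ x → x ∈ L → g x ≡ f x)

EmptyRelation : Graph → Set
EmptyRelation A = ∀ x y → ¬ E A x y

-- (2) every connected component is isomorphic to K₂: the component of x
-- (vertices reachable from x) is exactly {x, y} with x ≠ y adjacent.
ComponentsK₂ : Graph → Set
ComponentsK₂ A = ∀ (x : V A) → ∃ λ (y : V A) →
  x ≢ y × E A x y × (∀ z → Star (E A) x z → z ≡ x ⊎ z ≡ y)

-- Rado graph on ℕ (Ackermann/BIT construction): i ~ j iff i < j and the
-- i-th binary digit of j is 1, or symmetrically.
bit : ℕ → ℕ → Set
bit m zero    = m % 2 ≡ 1
bit m (suc i) = bit (m / 2) i

RadoEdge : ℕ → ℕ → Set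
RadoEdge i j = (i < j × bit j i) ⊎ (j < i × bit i j)

HasRadoSpanningSubgraph : Graph → Set₁
HasRadoSpanningSubgraph A =
  ∃ λ (R : V A → V A → Set) → (∀ x y → R x y → E A x y) ×
    (Σ (ℕ → V A) λ h → Bijective _≡_ _≡_ h × (∀ i j → RadoEdge i j ⇔ R (h i) (h j)))

-- If some vertex a has two distinct neighbours b and c, every finite family
-- u₀, …, uₙ₋₁ of vertices has a common neighbour: the vectors b(b…c…b) of A^(n+1),
-- with c in position i, are pairwise non-adjacent (their first coordinates agree)
-- and all adjacent to the constant vector a…a, so the local polymorphism sending
-- the i-th of them to uᵢ extends, and the extension maps a…a to a common
-- neighbour. A back-and-forth enumeration of the countable graph then yields a
-- bijection from the Rado graph mapping edges to edges: a forth step gives the next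
-- index a common neighbour of all vertices used so far, and a back step gives a
-- missing vertex a fresh power of two as index, which is adjacent to no smaller
-- index. Otherwise every vertex has at most one neighbour; once there is an edge
-- ab, extending the unary map a ↦ v to b shows that no v is isolated, so the
-- components are copies of K₂.
--
-- Conversely, a local polymorphism f with finite domain L ⊆ A^k is extended by a
-- default value off L. For K₂ components, a point with a neighbour z in L goes to
-- the partner of f z (neighbours in A^k are unique), any other point to its first
-- coordinate. For a Rado spanning subgraph, a point x ∉ L goes to the member, with
-- number the code of its first coordinate, of an infinite Rado clique all of whose
-- members are adjacent to the finitely many values of f; adjacent points have
-- distinct first coordinates.
module Submission where

open import Defs
open import Level using (0ℓ)
open import Axiom.ExcludedMiddle using (ExcludedMiddle)
open import Data.Empty using (⊥-elim)
open import Data.Fin using (Fin; zero; suc)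
open import Data.List using (List; []; _∷_; map; tabulate; length; lookup)
open import Data.List.Extrema.Nat using (max; xs≤max)
open import Data.List.Membership.Propositional using (_∈_; _∉_)
open import Data.List.Membership.Propositional.Properties using (∈-map⁺; ∈-tabulate⁺; ∈-tabulate⁻)
open import Data.List.Relation.Binary.Subset.Propositional using (_⊆_)
import Data.List.Relation.Unary.All as All
open import Data.List.Relation.Unary.Any using (here; there; index)
open import Data.List.Relation.Unary.Any.Properties using (lookup-index)
open import Data.Nat
open import Data.Nat.DivMod
open import Data.Nat.Divisibility using (divides-refl)
open import Data.Nat.Properties
open import Data.Product using (∃; _×_; _,_; proj₁; proj₂)
open import Data.Sum using (_⊎_; inj₁; inj₂)
open import Data.Vec using (Vec; []; _∷_; head; tail; replicate)
import Data.Vec.Relation.Binary.Pointwise.Inductive as Pointwise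
open Pointwise using ([]; _∷_)
open import Function using (_∘_; id)
open import Function.Bundles using (Equivalence; mk⇔)
open import Function.Definitions using (Injective)
open import Relation.Binary.Construct.Closure.ReflexiveTransitive using (Star; ε; _◅_)
open import Relation.Binary.Definitions using (tri<; tri≈; tri>)
open import Relation.Binary.PropositionalEquality
open import Relation.Nullary using (¬_; Dec; yes; no; contradiction)
open import Relation.Nullary.Decidable using (decidable-stable)

2^-suc : ∀ p → 2 ^ suc p ≡ 2 ^ p * 2
2^-suc p = *-comm 2 (2 ^ p)

2^-suc-≡-+ : ∀ p → 2 ^ suc p ≡ 2 ^ p + 2 ^ p
2^-suc-≡-+ p = cong (2 ^ p +_) (+-identityʳ (2 ^ p))

+-2^-suc-%2 : ∀ a p → (a + 2 ^ suc p) % 2 ≡ a % 2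
+-2^-suc-%2 a p rewrite 2^-suc p = [m+kn]%n≡m%n a (2 ^ p) 2

+-2^-suc-/2 : ∀ a p → (a + 2 ^ suc p) / 2 ≡ a / 2 + 2 ^ p
+-2^-suc-/2 a p rewrite 2^-suc p =
  trans (+-distrib-/-∣ʳ a (divides-refl (2 ^ p))) (cong (a / 2 +_) (m*n/n≡m (2 ^ p) 2))

/2-<-2^ : ∀ {a} p → a < 2 ^ suc p → a / 2 < 2 ^ p
/2-<-2^ {a} p a<2^[1+p] = m<n*o⇒m/o<n (subst (a <_) (2^-suc p) a<2^[1+p])

n<2^n : ∀ n → n < 2 ^ n
n<2^n zero = s≤s z≤n
n<2^n (suc n) = subst (suc n <_) (sym (2^-suc-≡-+ n)) (+-mono-≤ (m^n>0 2 n) (n<2^n n))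

bit-+-2^-below : ∀ p {q a} → a < 2 ^ p → q < p → bit a q → bit (a + 2 ^ p) q
bit-+-2^-below (suc p) {zero} {a} _ _ a₀ = trans (+-2^-suc-%2 a p) a₀
bit-+-2^-below (suc p) {suc q} {a} a<2^p (s≤s q<p) aq =
  subst (λ x → bit x q) (sym (+-2^-suc-/2 a p)) (bit-+-2^-below p (/2-<-2^ p a<2^p) q<p aq)

bit-+-2^ : ∀ p {a} → a < 2 ^ p → bit (a + 2 ^ p) p
bit-+-2^ zero {zero} _ = refl
bit-+-2^ zero {suc a} (s≤s ())
bit-+-2^ (suc p) {a} a<2^p =
  subst (λ x → bit x p) (sym (+-2^-suc-/2 a p)) (bit-+-2^ p (/2-<-2^ p a<2^p))

¬bit-2^ : ∀ M {i} → i < M → ¬ bit (2 ^ M) i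
¬bit-2^ (suc M) {zero} _ 2^M₀ with trans (sym (+-2^-suc-%2 0 M)) 2^M₀
... | ()
¬bit-2^ (suc M) {suc i} (s≤s i<M) 2^Mᵢ = ¬bit-2^ M i<M (subst (λ x → bit x i) (+-2^-suc-/2 0 M) 2^Mᵢ)

allOnes : ℕ → ℕ
allOnes zero = 0
allOnes (suc n) = allOnes n + 2 ^ n

allOnes-< : ∀ n → allOnes n < 2 ^ n
allOnes-< zero = s≤s z≤n
allOnes-< (suc n) = subst (allOnes (suc n) <_) (sym (2^-suc-≡-+ n)) (+-monoˡ-< (2 ^ n) (allOnes-< n))

n≤allOnes : ∀ n → n ≤ allOnes n
n≤allOnes zero = z≤n
n≤allOnes (suc n) = subst (_≤ allOnes (suc n)) (+-comm n 1) (+-mono-≤ (n≤allOnes n) (m^n>0 2 n))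

bit-allOnes : ∀ n {q} → q < n → bit (allOnes n) q
bit-allOnes (suc n) {q} (s≤s q≤n) with m≤n⇒m<n∨m≡n q≤n
... | inj₁ q<n = bit-+-2^-below n (allOnes-< n) q<n (bit-allOnes n q<n)
... | inj₂ refl = bit-+-2^ q (allOnes-< q)

RadoEdge-irrefl : ∀ {i} → ¬ RadoEdge i i
RadoEdge-irrefl (inj₁ (i<i , _)) = <-irrefl refl i<i
RadoEdge-irrefl (inj₂ (i<i , _)) = <-irrefl refl i<i

RadoEdge-sym : ∀ {i j} → RadoEdge i j → RadoEdge j i
RadoEdge-sym (inj₁ e) = inj₂ e
RadoEdge-sym (inj₂ e) = inj₁ e

¬RadoEdge-2^ : ∀ {i M} → i < M → ¬ RadoEdge (2 ^ M) i
¬RadoEdge-2^ {M = M} i<M (inj₁ (2^M<i , _)) = <-asym 2^M<i (<-trans i<M (n<2^n M))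
¬RadoEdge-2^ {M = M} i<M (inj₂ (_ , 2^Mᵢ)) = ¬bit-2^ M i<M 2^Mᵢ

-- clique n has the bits 0, …, B-1 and the bits clique m, m < n, set.
module RadoClique (B : ℕ) where

  clique : ℕ → ℕ
  clique zero = allOnes B
  clique (suc n) = clique n + 2 ^ clique n

  clique-<-suc : ∀ n → clique n < clique (suc n)
  clique-<-suc n = m<m+n (clique n) (m^n>0 2 (clique n))

  clique-mono : ∀ {m n} → m ≤′ n → clique m ≤ clique n
  clique-mono (≤′-reflexive refl) = ≤-refl
  clique-mono (≤′-step {n} m≤′n) = ≤-trans (clique-mono m≤′n) (<⇒≤ (clique-<-suc n))

  bit-clique-mono : ∀ {m n q} → m ≤′ n → q < clique m → bit (clique m) q → bit (clique n) q
  bit-clique-mono (≤′-reflexive refl) _ mq = mq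
  bit-clique-mono (≤′-step {n} m≤′n) q<m mq =
    bit-+-2^-below (clique n) (n<2^n (clique n))
      (<-≤-trans q<m (clique-mono m≤′n)) (bit-clique-mono m≤′n q<m mq)

  clique-adjacent-< : ∀ {m n} → m < n → RadoEdge (clique m) (clique n)
  clique-adjacent-< {m} m<n =
    inj₁ ( <-≤-trans (clique-<-suc m) (clique-mono (≤⇒≤′ m<n))
         , bit-clique-mono (≤⇒≤′ m<n) (clique-<-suc m) (bit-+-2^ (clique m) (n<2^n (clique m))) )

  clique-adjacent : ∀ {m n} → m ≢ n → RadoEdge (clique m) (clique n)
  clique-adjacent {m} {n} m≢n with <-cmp m n
  ... | tri< m<n _ _ = clique-adjacent-< m<n
  ... | tri≈ _ m≡n _ = contradiction m≡n m≢n
  ... | tri> _ _ n<m = RadoEdge-sym (clique-adjacent-< n<m)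

  below-adjacent-clique : ∀ {i} n → i < B → RadoEdge i (clique n)
  below-adjacent-clique n i<B =
    inj₁ ( <-≤-trans i<B (≤-trans (n≤allOnes B) (clique-mono (≤⇒≤′ (z≤n {n}))))
         , bit-clique-mono (≤⇒≤′ (z≤n {n})) (<-≤-trans i<B (n≤allOnes B)) (bit-allOnes B i<B) )

∈⇒<suc-max : ∀ {n xs} → n ∈ xs → n < suc (max 0 xs)
∈⇒<suc-max n∈xs = s≤s (All.lookup (xs≤max 0 _) n∈xs)

PolymorphicExtension : (A : Graph) (k : ℕ) → List (Vec (V A) k) → (Vec (V A) k → V A) → Set
PolymorphicExtension A k L f = ∃ λ g → IsPolymorphism A k g × (∀ x → x ∈ L → g x ≡ f x)

HasTwoNeighbours : Graph → Set
HasTwoNeighbours A = ∃ λ a → ∃ λ b → ∃ λ c → E A a b × E A a c × b ≢ c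

HasCommonNeighbours : Graph → Set
HasCommonNeighbours A = ∀ (xs : List (V A)) → ∃ λ z → ∀ {w} → w ∈ xs → E A z w

module _ {A : Graph} where

  UniqueNeighbours : Set
  UniqueNeighbours = ∀ {x y z} → E A x y → E A x z → y ≡ z

  Eᵏ-sym : ∀ {k} {x y : Vec (V A) k} → Eᵏ A k x y → Eᵏ A k y x
  Eᵏ-sym = Pointwise.sym (E-sym A)

  Eᵏ-head : ∀ {k} {x y : Vec (V A) (suc k)} → Eᵏ A (suc k) x y → E A (head x) (head y)
  Eᵏ-head (x₀y₀ ∷ _) = x₀y₀

  Eᵏ-unique : UniqueNeighbours → ∀ {k} {x y z : Vec (V A) k} → Eᵏ A k x y → Eᵏ A k x z → y ≡ z
  Eᵏ-unique unique [] [] = refl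
  Eᵏ-unique unique (xy ∷ xsys) (xz ∷ xszs) = cong₂ _∷_ (unique xy xz) (Eᵏ-unique unique xsys xszs)

  componentsK₂⇒uniqueNeighbours : ComponentsK₂ A → UniqueNeighbours
  componentsK₂⇒uniqueNeighbours K {x} xy xz = trans (≡-partner xy) (sym (≡-partner xz))
    where
    ≡-partner : ∀ {w} → E A x w → w ≡ proj₁ (K x)
    ≡-partner {w} xw with proj₂ (proj₂ (proj₂ (K x))) w (xw ◅ ε)
    ... | inj₁ refl = contradiction xw (E-irr A)
    ... | inj₂ w≡partner = w≡partner

  uniqueNeighbours⇒componentsK₂ : (∀ v → ∃ (E A v)) → UniqueNeighbours → ComponentsK₂ A
  uniqueNeighbours⇒componentsK₂ neighbour unique x with neighbour x
  ... | y , xy = y , (λ { refl → E-irr A xy }) , xy , λ _ → reachable (inj₁ refl)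
    where
    reachable : ∀ {u z} → u ≡ x ⊎ u ≡ y → Star (E A) u z → z ≡ x ⊎ z ≡ y
    reachable u∈xy ε = u∈xy
    reachable (inj₁ refl) (xw ◅ wz) = reachable (inj₂ (unique xw xy)) wz
    reachable (inj₂ refl) (yw ◅ wz) = reachable (inj₁ (unique yw (E-sym A xy))) wz

  emptyRelation⇒homogeneous : EmptyRelation A → PolymorphismHomogeneous A
  emptyRelation⇒homogeneous empty (suc _) _ _ f _ =
    f , (λ { _ _ (xy ∷ _) → ⊥-elim (empty _ _ xy) }) , λ _ _ → refl

  homogeneous⇒neighbour : PolymorphismHomogeneous A → ∀ {a b} → E A a b → ∀ v → ∃ (E A v)
  homogeneous⇒neighbour homogeneous {a} {b} ab v =
    let (g , g-hom , g≡v) = homogeneous 1 (s≤s z≤n) ((a ∷ []) ∷ []) (λ _ → v) constant-local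
    in g (b ∷ []) , subst (λ u → E A u (g (b ∷ []))) (g≡v (a ∷ []) (here refl)) (g-hom _ _ (ab ∷ []))
    where
    constant-local : IsLocalPolymorphism A 1 ((a ∷ []) ∷ []) (λ _ → v)
    constant-local _ _ (here refl) (here refl) (aa ∷ []) = contradiction aa (E-irr A)

  module _ (em : ExcludedMiddle 0ℓ) where

    extend-by-default : ∀ {k L f} → IsLocalPolymorphism A k L f → (d : Vec (V A) k → V A) →
      (∀ x y → x ∈ L → y ∉ L → Eᵏ A k x y → E A (f x) (d y)) →
      (∀ x y → x ∉ L → y ∉ L → Eᵏ A k x y → E A (d x) (d y)) →
      PolymorphicExtension A k L f
    extend-by-default {k} {L} {f} f-local d border outside =
      (λ x → g x em) , (λ x y xy → g-hom xy em em) , λ x x∈L → g-agrees x∈L em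
      where
      g : ∀ x → Dec (x ∈ L) → V A
      g x (yes _) = f x
      g x (no _) = d x
      g-hom : ∀ {x y} → Eᵏ A k x y → ∀ dx dy → E A (g x dx) (g y dy)
      g-hom xy (yes x∈L) (yes y∈L) = f-local _ _ x∈L y∈L xy
      g-hom xy (yes x∈L) (no y∉L) = border _ _ x∈L y∉L xy
      g-hom xy (no x∉L) (yes y∈L) = E-sym A (border _ _ y∈L x∉L (Eᵏ-sym xy))
      g-hom xy (no x∉L) (no y∉L) = outside _ _ x∉L y∉L xy
      g-agrees : ∀ {x} → x ∈ L → ∀ dx → g x dx ≡ f x
      g-agrees _ (yes _) = refl
      g-agrees x∈L (no x∉L) = contradiction x∈L x∉L

    componentsK₂⇒homogeneous : ComponentsK₂ A → PolymorphismHomogeneous A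
    componentsK₂⇒homogeneous K (suc k) _ L f f-local = extend-by-default f-local d border outside
      where
      partner : V A → V A
      partner x = proj₁ (K x)
      partner-adjacent : ∀ x → E A x (partner x)
      partner-adjacent x = proj₁ (proj₂ (proj₂ (K x)))
      unique : ∀ {x y z} → Eᵏ A (suc k) x y → Eᵏ A (suc k) x z → y ≡ z
      unique = Eᵏ-unique (componentsK₂⇒uniqueNeighbours K)
      d′ : ∀ y → Dec (∃ λ z → z ∈ L × Eᵏ A (suc k) z y) → V A
      d′ y (yes (z , _)) = partner (f z)
      d′ y (no _) = head y
      d : Vec (V A) (suc k) → V A
      d y = d′ y em
      border : ∀ x y → x ∈ L → y ∉ L → Eᵏ A (suc k) x y → E A (f x) (d y)
      border x y x∈L _ xy = border′ em
        where
        border′ : ∀ dy → E A (f x) (d′ y dy)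
        border′ (yes (z , _ , zy)) rewrite unique (Eᵏ-sym zy) (Eᵏ-sym xy) = partner-adjacent (f x)
        border′ (no no-neighbour) = contradiction (x , x∈L , xy) no-neighbour
      outside : ∀ x y → x ∉ L → y ∉ L → Eᵏ A (suc k) x y → E A (d x) (d y)
      outside x y x∉L y∉L xy = outside′ em em
        where
        outside′ : ∀ dx dy → E A (d′ x dx) (d′ y dy)
        outside′ (yes (z , z∈L , zx)) _ = contradiction (subst (_∈ L) (unique (Eᵏ-sym zx) xy) z∈L) y∉L
        outside′ (no _) (yes (z , z∈L , zy)) =
          contradiction (subst (_∈ L) (unique (Eᵏ-sym zy) (Eᵏ-sym xy)) z∈L) x∉L
        outside′ (no _) (no _) = Eᵏ-head xy

    radoSpanning⇒homogeneous : Countable A → HasRadoSpanningSubgraph A → PolymorphismHomogeneous A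
    radoSpanning⇒homogeneous (ι , ι-injective) (R , R⊆E , h , (_ , h-surjective) , h-iso)
                             (suc k) _ L f f-local =
      extend-by-default f-local d border outside
      where
      h⁻¹ : V A → ℕ
      h⁻¹ w = proj₁ (h-surjective w)
      h∘h⁻¹ : ∀ w → h (h⁻¹ w) ≡ w
      h∘h⁻¹ w = proj₂ (h-surjective w) refl
      open RadoClique (suc (max 0 (map (h⁻¹ ∘ f) L)))
      RadoEdge⇒E : ∀ {i j} → RadoEdge i j → E A (h i) (h j)
      RadoEdge⇒E {i} {j} ij = R⊆E _ _ (Equivalence.to (h-iso i j) ij)
      d : Vec (V A) (suc k) → V A
      d x = h (clique (ι (head x)))
      border : ∀ x y → x ∈ L → y ∉ L → Eᵏ A (suc k) x y → E A (f x) (d y)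
      border x y x∈L _ _ = subst (λ w → E A w (d y)) (h∘h⁻¹ (f x))
        (RadoEdge⇒E (below-adjacent-clique (ι (head y)) (∈⇒<suc-max (∈-map⁺ (h⁻¹ ∘ f) x∈L))))
      outside : ∀ x y → x ∉ L → y ∉ L → Eᵏ A (suc k) x y → E A (d x) (d y)
      outside x y _ _ xy = RadoEdge⇒E (clique-adjacent λ same-code →
        E-irr A (subst (λ w → E A w (head y)) (ι-injective same-code) (Eᵏ-head xy)))

    module Spikes {a b c : V A} (ab : E A a b) (ac : E A a c) (b≢c : b ≢ c) where

      marked : ∀ {n} → Fin n → Vec (V A) n
      marked {suc n} zero = c ∷ replicate n b
      marked (suc i) = b ∷ marked i

      spike : ∀ {n} → Fin n → Vec (V A) (suc n)
      spike i = b ∷ marked i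

      marked-injective : ∀ {n} {i j : Fin n} → marked i ≡ marked j → i ≡ j
      marked-injective {i = zero} {zero} _ = refl
      marked-injective {i = zero} {suc j} c∷≡b∷ = contradiction (cong head c∷≡b∷) (b≢c ∘ sym)
      marked-injective {i = suc i} {zero} b∷≡c∷ = contradiction (cong head b∷≡c∷) b≢c
      marked-injective {i = suc i} {suc j} b∷≡b∷ = cong suc (marked-injective (cong tail b∷≡b∷))

      spike-injective : ∀ {n} {i j : Fin n} → spike i ≡ spike j → i ≡ j
      spike-injective = marked-injective ∘ cong tail

      spikes-independent : ∀ {n} (i j : Fin n) → ¬ Eᵏ A (suc n) (spike i) (spike j)
      spikes-independent i j (bb ∷ _) = E-irr A bb

      replicate-adjacent : ∀ n → Eᵏ A n (replicate n a) (replicate n b)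
      replicate-adjacent zero = []
      replicate-adjacent (suc n) = ab ∷ replicate-adjacent n

      replicate-adjacent-marked : ∀ {n} (i : Fin n) → Eᵏ A n (replicate n a) (marked i)
      replicate-adjacent-marked {suc n} zero = ac ∷ replicate-adjacent n
      replicate-adjacent-marked (suc i) = ab ∷ replicate-adjacent-marked i

      replicate-adjacent-spike : ∀ {n} (i : Fin n) → Eᵏ A (suc n) (replicate (suc n) a) (spike i)
      replicate-adjacent-spike i = ab ∷ replicate-adjacent-marked i

    homogeneous⇒commonNeighbours : PolymorphismHomogeneous A → HasTwoNeighbours A → HasCommonNeighbours A
    homogeneous⇒commonNeighbours homogeneous (a , b , c , ab , ac , b≢c) xs =
      g (replicate (suc n) a) , λ w∈xs →
        subst (E A _) (trans (g-spike (index w∈xs)) (sym (lookup-index w∈xs)))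
              (g-hom _ _ (replicate-adjacent-spike (index w∈xs)))
      where
      open Spikes ab ac b≢c
      n : ℕ
      n = length xs
      label′ : ∀ x → Dec (∃ λ i → spike i ≡ x) → V A
      label′ x (yes (i , _)) = lookup xs i
      label′ x (no _) = a
      label : Vec (V A) (suc n) → V A
      label x = label′ x em
      label-spike : ∀ i d → label′ (spike i) d ≡ lookup xs i
      label-spike i (yes (j , spike-j≡i)) = cong (lookup xs) (spike-injective spike-j≡i)
      label-spike i (no ¬spike) = contradiction (i , refl) ¬spike
      label-local : IsLocalPolymorphism A (suc n) (tabulate spike) label
      label-local x y x∈ y∈ xy with ∈-tabulate⁻ x∈ | ∈-tabulate⁻ y∈
      ... | i , refl | j , refl = contradiction xy (spikes-independent i j)
      extension : PolymorphicExtension A (suc n) (tabulate spike) label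
      extension = homogeneous (suc n) (s≤s z≤n) (tabulate spike) label label-local
      g : Vec (V A) (suc n) → V A
      g = proj₁ extension
      g-hom : IsPolymorphism A (suc n) g
      g-hom = proj₁ (proj₂ extension)
      g-spike : ∀ i → g (spike i) ≡ lookup xs i
      g-spike i = trans (proj₂ (proj₂ extension) (spike i) (∈-tabulate⁺ i)) (label-spike i em)

    module BackAndForth (ι : V A → ℕ) (ι-injective : Injective _≡_ _≡_ ι)
                        (common : HasCommonNeighbours A) where

      Assignment : Set
      Assignment = List (ℕ × V A)

      record IsPartialEmbedding (s : Assignment) : Set where
        field
          functional  : ∀ {i v w} → (i , v) ∈ s → (i , w) ∈ s → v ≡ w
          injective   : ∀ {i j v} → (i , v) ∈ s → (j , v) ∈ s → i ≡ j
          homomorphic : ∀ {i j v w} → (i , v) ∈ s → (j , w) ∈ s → RadoEdge i j → E A v w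
      open IsPartialEmbedding

      apex : Assignment → V A
      apex s = proj₁ (common (map proj₂ s))

      apex-adjacent : ∀ s {j w} → (j , w) ∈ s → E A (apex s) w
      apex-adjacent s jw∈s = proj₂ (common (map proj₂ s)) (∈-map⁺ proj₂ jw∈s)

      forth : ∀ n s → Dec (∃ λ v → (n , v) ∈ s) → Assignment
      forth n s (yes _) = s
      forth n s (no _) = (n , apex s) ∷ s

      forth-⊇ : ∀ n s d → s ⊆ forth n s d
      forth-⊇ n s (yes _) = id
      forth-⊇ n s (no _) = there

      forth-defines : ∀ n s d → ∃ λ v → (n , v) ∈ forth n s d
      forth-defines n s (yes nv∈s) = nv∈s
      forth-defines n s (no _) = apex s , here refl

      forth-preserves : ∀ n s d → IsPartialEmbedding s → IsPartialEmbedding (forth n s d)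
      forth-preserves n s (yes _) s-emb = s-emb
      forth-preserves n s (no n∉dom) s-emb = record
        { functional = λ where
            (here refl) (here refl) → refl
            (here refl) (there nw∈s) → contradiction (_ , nw∈s) n∉dom
            (there nv∈s) (here refl) → contradiction (_ , nv∈s) n∉dom
            (there iv∈s) (there iw∈s) → functional s-emb iv∈s iw∈s
        ; injective = λ where
            (here refl) (here refl) → refl
            (here refl) (there jv∈s) → contradiction (apex-adjacent s jv∈s) (E-irr A)
            (there iv∈s) (here refl) → contradiction (apex-adjacent s iv∈s) (E-irr A)
            (there iv∈s) (there jv∈s) → injective s-emb iv∈s jv∈s
        ; homomorphic = λ where
            (here refl) (here refl) nn → contradiction nn RadoEdge-irrefl
            (here refl) (there jw∈s) _ → apex-adjacent s jw∈s
            (there iv∈s) (here refl) _ → E-sym A (apex-adjacent s iv∈s)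
            (there iv∈s) (there jw∈s) ij → homomorphic s-emb iv∈s jw∈s ij
        }

      bound : Assignment → ℕ
      bound s = suc (max 0 (map proj₁ s))

      index<bound : ∀ s {i v} → (i , v) ∈ s → i < bound s
      index<bound s iv∈s = ∈⇒<suc-max (∈-map⁺ proj₁ iv∈s)

      Unassigned : ℕ → Assignment → Set
      Unassigned n s = ∃ λ v → ι v ≡ n × ¬ (∃ λ i → (i , v) ∈ s)

      -- The fresh index 2 ^ bound s is Rado-adjacent to no index of s (¬RadoEdge-2^),
      -- so the new vertex v needs no edges.
      back : ∀ n s → Dec (Unassigned n s) → Assignment
      back n s (yes (v , _)) = (2 ^ bound s , v) ∷ s
      back n s (no _) = s

      back-⊇ : ∀ n s d → s ⊆ back n s d
      back-⊇ n s (yes _) = there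
      back-⊇ n s (no _) = id

      back-covers : ∀ n s d {v} → ι v ≡ n → ∃ λ i → (i , v) ∈ back n s d
      back-covers n s (yes (w , ιw≡n , _)) ιv≡n =
        _ , subst (λ u → (_ , u) ∈ _) (ι-injective (trans ιw≡n (sym ιv≡n))) (here refl)
      back-covers n s (no all-assigned) {v} ιv≡n =
        decidable-stable em λ v-unassigned → all-assigned (v , ιv≡n , v-unassigned)

      back-preserves : ∀ n s d → IsPartialEmbedding s → IsPartialEmbedding (back n s d)
      back-preserves n s (no _) s-emb = s-emb
      back-preserves n s (yes (v , _ , v∉ran)) s-emb = record
        { functional = λ where
            (here refl) (here refl) → refl
            (here refl) (there iw∈s) → contradiction (index<2^bound iw∈s) (<-irrefl refl)
            (there iv∈s) (here refl) → contradiction (index<2^bound iv∈s) (<-irrefl refl)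
            (there iv∈s) (there iw∈s) → functional s-emb iv∈s iw∈s
        ; injective = λ where
            (here refl) (here refl) → refl
            (here refl) (there jv∈s) → contradiction (_ , jv∈s) v∉ran
            (there iv∈s) (here refl) → contradiction (_ , iv∈s) v∉ran
            (there iv∈s) (there jv∈s) → injective s-emb iv∈s jv∈s
        ; homomorphic = λ where
            (here refl) (here refl) nn → contradiction nn RadoEdge-irrefl
            (here refl) (there jw∈s) nj → contradiction nj (¬RadoEdge-2^ (index<bound s jw∈s))
            (there iv∈s) (here refl) in′ →
              contradiction (RadoEdge-sym in′) (¬RadoEdge-2^ (index<bound s iv∈s))
            (there iv∈s) (there jw∈s) ij → homomorphic s-emb iv∈s jw∈s ij
        }
        where
        index<2^bound : ∀ {i w} → (i , w) ∈ s → i < 2 ^ bound s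
        index<2^bound iw∈s = <-trans (index<bound s iw∈s) (n<2^n (bound s))

      stage : ℕ → Assignment
      stage zero = []
      stage (suc n) = back n (forth n (stage n) em) em

      stage-embedding : ∀ n → IsPartialEmbedding (stage n)
      stage-embedding zero = record { functional = λ () ; injective = λ () ; homomorphic = λ () }
      stage-embedding (suc n) = back-preserves n _ em (forth-preserves n _ em (stage-embedding n))

      stage-mono : ∀ {m n} → m ≤′ n → stage m ⊆ stage n
      stage-mono (≤′-reflexive refl) = id
      stage-mono (≤′-step {n} m≤′n) = back-⊇ n _ em ∘ forth-⊇ n _ em ∘ stage-mono m≤′n

      stage-defines : ∀ i → ∃ λ v → (i , v) ∈ stage (suc i)
      stage-defines i with forth-defines i (stage i) em
      ... | v , iv∈ = v , back-⊇ i _ em iv∈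

      stage-covers : ∀ v → ∃ λ i → (i , v) ∈ stage (suc (ι v))
      stage-covers v = back-covers (ι v) _ em refl

      embedding : ℕ → V A
      embedding i = proj₁ (stage-defines i)

      embedding-∈ : ∀ {i n} → i ≤ n → (i , embedding i) ∈ stage (suc n)
      embedding-∈ {i} i≤n = stage-mono (≤⇒≤′ (s≤s i≤n)) (proj₂ (stage-defines i))

      embedding-injective : Injective _≡_ _≡_ embedding
      embedding-injective {i} {j} hi≡hj = injective (stage-embedding (suc (i + j)))
        (embedding-∈ (m≤m+n i j))
        (subst (λ w → (j , w) ∈ stage (suc (i + j))) (sym hi≡hj) (embedding-∈ (m≤n+m j i)))

      embedding-homomorphic : ∀ {i j} → RadoEdge i j → E A (embedding i) (embedding j)
      embedding-homomorphic {i} {j} = homomorphic (stage-embedding (suc (i + j)))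
        (embedding-∈ (m≤m+n i j)) (embedding-∈ (m≤n+m j i))

      embedding-surjective : ∀ v → ∃ λ i → ∀ {j} → j ≡ i → embedding j ≡ v
      embedding-surjective v with stage-covers v
      ... | i , iv∈ = i , λ { refl → functional (stage-embedding (suc (i + ι v)))
          (embedding-∈ (m≤m+n i (ι v))) (stage-mono (≤⇒≤′ (s≤s (m≤n+m (ι v) i))) iv∈) }

      hasRadoSpanningSubgraph : HasRadoSpanningSubgraph A
      hasRadoSpanningSubgraph =
        R , R⊆E , embedding , (embedding-injective , embedding-surjective) ,
        λ i j → mk⇔ (λ ij → i , j , refl , refl , ij)
                    λ { (i′ , j′ , hi′≡hi , hj′≡hj , i′j′) →
                          subst₂ RadoEdge (embedding-injective hi′≡hi) (embedding-injective hj′≡hj) i′j′ }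
        where
        R : V A → V A → Set
        R x y = ∃ λ i → ∃ λ j → embedding i ≡ x × embedding j ≡ y × RadoEdge i j
        R⊆E : ∀ x y → R x y → E A x y
        R⊆E _ _ (_ , _ , refl , refl , ij) = embedding-homomorphic ij

    homogeneous⇒trichotomy : Countable A → PolymorphismHomogeneous A →
                             EmptyRelation A ⊎ ComponentsK₂ A ⊎ HasRadoSpanningSubgraph A
    homogeneous⇒trichotomy (ι , ι-injective) homogeneous with em {HasTwoNeighbours A}
    ... | yes two = inj₂ (inj₂ (BackAndForth.hasRadoSpanningSubgraph ι ι-injective
                                  (homogeneous⇒commonNeighbours homogeneous two)))
    ... | no ¬two with em {∃ λ a → ∃ (E A a)}
    ...   | no no-edge = inj₁ λ x y xy → no-edge (x , y , xy)
    ...   | yes (_ , _ , ab) =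
      inj₂ (inj₁ (uniqueNeighbours⇒componentsK₂ (homogeneous⇒neighbour homogeneous ab) unique))
      where
      unique : UniqueNeighbours
      unique {x} {y} {z} xy xz = decidable-stable em λ y≢z → ¬two (x , y , z , xy , xz , y≢z)

mainTheorem1 : ExcludedMiddle 0ℓ → ExcludedMiddle (Level.suc 0ℓ) → (A : Graph) → Countable A →
    (PolymorphismHomogeneous A → EmptyRelation A ⊎ ComponentsK₂ A ⊎ HasRadoSpanningSubgraph A)
    × (EmptyRelation A ⊎ ComponentsK₂ A ⊎ HasRadoSpanningSubgraph A → PolymorphismHomogeneous A)
mainTheorem1 em _ A countable = homogeneous⇒trichotomy {A} em countable , λ where
  (inj₁ empty) → emptyRelation⇒homogeneous {A} empty
  (inj₂ (inj₁ K₂)) → componentsK₂⇒homogeneous {A} em K₂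
  (inj₂ (inj₂ rado)) → radoSpanning⇒homogeneous {A} em countable rado
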